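{- Let $\mathcal{S}$ be a realizability structure and $n$ a positive integer. A term $\phi$ realizes $\mathrm{N}_n$ with respect to $\mathcal{S}$ if and only if $\phi$ is an $n$-voting instruction modulo $\succ_{\mathcal{S}}$.
   Context: $\lambda_c$-calculus. Fix a countably infinite set of variables. $\lambda_c$-terms: $t,u ::= x \mid tu \mid \lambda x.t \mid \mathrm{cc} \mid k_\pi$ ($\pi$ a stack) $\mid \kappa_m$ ($m\in\mathbb{N}$) $\mid \beta_m$ ($m\in\mathbb{N}$), modulo $\alpha$-equivalence. A term is a closed $\lambda_c$-term; $\Lambda$ is the set of terms. Stacks: $\pi ::= \omega_m \mid t\cdot\pi$ ($t\in\Lambda$); $\Pi$ is the set of stacks. Processes: $t\star\pi$ with $t\in\Lambda,\pi\in\Pi$. One-step evaluation $\succ_1$: $tu\star\pi \succ_1 t\star u\cdot\pi$, $\lambda x.t\star u\cdot\pi\succ_1 t[x:=u]\star\pi$, $\mathrm{cc}\star t\cdot\pi\succ_1 t\star k_\pi\cdot\pi$, $k_{\pi'}\star t\cdot\pi\succ_1 t\star\pi'$; $\succ$ is its reflexive-transitive closure. A pole is a set $\perp\!\!\!\perp$ of processes with $p\succ q$, $q\in\perp\!\!\!\perp\Rightarrow p\in\perp\!\!\!\perp$. A realizability structure is a set $\mathcal{S}$ of poles. Formulas used: $\top$, second-order nullary variables $X$, $A\to B$ (right-associative), $A\cap B$, $\forall X\,A$. For a pole: $\|\top\|=\emptyset$, $\|A\to B\|=\{t\cdot\pi:t\in|A|,\pi\in\|B\|\}$, $\|A\cap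 B\|=\|A\|\cup\|B\|$, $\|\forall X\,A\|=\bigcup_{S\subseteq\Pi}\|A[X:=S]\|$, $\|S\|=S$ for $S\subseteq\Pi$; $|A|=\{t\in\Lambda:\forall\pi\in\|A\|,\ t\star\pi\in\perp\!\!\!\perp\}$; $t$ realizes $A$ w.r.t. $\perp\!\!\!\perp$ if $t\in|A|$, and w.r.t. $\mathcal{S}$ if it does so for every $\perp\!\!\!\perp\in\mathcal{S}$. $\mathrm{N}_n$ is the formula $\forall X\,(B_1\cap\cdots\cap B_n)$ where $B_i$ is $C_{i,1}\to\cdots\to C_{i,n}\to X$ with $C_{i,i}=\top$ and $C_{i,k}=X$ for $k\ne i$. For a realizability structure $\mathcal{S}$, $\succ_{\mathcal{S}}$ is the binary relation on sets of processes defined by: $P\succ_{\mathcal{S}}Q$ iff for every $\perp\!\!\!\perp\in\mathcal{S}$, $Q\subseteq\perp\!\!\!\perp$ implies $P\cap\perp\!\!\!\perp\neq\emptyset$. An $n$-voting instruction modulo a relation $\succ'$ on sets of processes is a term $\phi$ such that for all terms $t_1,\dots,t_n$, all stacks $\pi$ and all $j\in\{1,\dots,n\}$, $\{\phi\star t_1\cdot\ldots\cdot t_n\cdot\pi\}\succ'\{t_i\star\pi: i\neq j\}$. -}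

module Defs where

open import Level using (Level; Lift; lift; 0ℓ) renaming (suc to lsuc)
open import Data.Nat using (ℕ; zero; suc; NonZero)
open import Data.Fin using (Fin; zero; suc)
open import Data.Empty using (⊥)
open import Data.Product using (Σ; ∃; _×_; _,_)
open import Data.Sum using (_⊎_)
open import Data.List using (List; []; _∷_; foldr)
open import Data.Vec.Functional using (Vector)
open import Relation.Binary.PropositionalEquality using (_≡_; _≢_)
open import Relation.Binary.Construct.Closure.ReflexiveTransitive using (Star)

-- λc-terms, in de Bruijn form (so α-equivalence is syntactic equality).
-- Tm k = λc-terms with at most k free variables; closed terms = Tm 0.

mutual
  data Tm (k : ℕ) : Set where
    var  : Fin k → Tm k
    app  : Tm k → Tm k → Tm k
    lam  : Tm (suc k) → Tm k
    cc   : Tm k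
    kont : Stack → Tm k
    κ    : ℕ → Tm k
    β    : ℕ → Tm k

  data Stack : Set where
    ω   : ℕ → Stack
    _·_ : Tm 0 → Stack → Stack

infixr 5 _·_

Λ : Set
Λ = Tm 0

Π : Set
Π = Stack

ext : ∀ {k l} → (Fin k → Fin l) → Fin (suc k) → Fin (suc l)
ext ρ zero    = zero
ext ρ (suc i) = suc (ρ i)

rename : ∀ {k l} → (Fin k → Fin l) → Tm k → Tm l
rename ρ (var i)   = var (ρ i)
rename ρ (app t u) = app (rename ρ t) (rename ρ u)
rename ρ (lam t)   = lam (rename (ext ρ) t)
rename ρ cc        = cc
rename ρ (kont π)  = kont π
rename ρ (κ m)     = κ m
rename ρ (β m)     = β m

exts : ∀ {k l} → (Fin k → Tm l) → Fin (suc k) → Tm (suc l)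
exts σ zero    = var zero
exts σ (suc i) = rename suc (σ i)

subst : ∀ {k l} → (Fin k → Tm l) → Tm k → Tm l
subst σ (var i)   = σ i
subst σ (app t u) = app (subst σ t) (subst σ u)
subst σ (lam t)   = lam (subst (exts σ) t)
subst σ cc        = cc
subst σ (kont π)  = kont π
subst σ (κ m)     = κ m
subst σ (β m)     = β m

_[0:=_] : Tm 1 → Tm 0 → Tm 0
t [0:= u ] = subst (λ { zero → u }) t

record Process : Set where
  constructor _★_
  field
    term  : Λ
    stack : Π

infix 4 _★_
infix 3 _≻₁_ _≻_

data _≻₁_ : Process → Process → Set where
  push  : ∀ {t u π}    → app t u ★ π ≻₁ t ★ u · π
  grab  : ∀ {t u π}    → lam t ★ u · π ≻₁ t [0:= u ] ★ π
  save  : ∀ {t π}      → cc ★ t · π ≻₁ t ★ kont π · π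
  restore : ∀ {π' t π} → kont π' ★ t · π ≻₁ t ★ π'

_≻_ : Process → Process → Set
_≻_ = Star _≻₁_

ProcSet : Set₁
ProcSet = Process → Set

StackSet : Set₁
StackSet = Stack → Set

record Pole : Set₁ where
  field
    carrier : ProcSet
    closed  : ∀ {p q} → p ≻ q → carrier q → carrier p
open Pole public

RealizabilityStructure : Set₂
RealizabilityStructure = Pole → Set₁

-- Formulas (second-order, nullary variables in de Bruijn form:
-- Formula m has m free second-order variables)

data Formula (m : ℕ) : Set where
  ⊤'   : Formula m
  X    : Fin m → Formula m
  _⇒_  : Formula m → Formula m → Formula m
  _∩_  : Formula m → Formula m → Formula m
  ∀X   : Formula (suc m) → Formula m

infixr 6 _⇒_
infixr 7 _∩_

Env : ℕ → Set₁
Env m = Fin m → StackSet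

_,,_ : ∀ {m} → Env m → StackSet → Env (suc m)
(ρ ,, S) zero    = S
(ρ ,, S) (suc i) = ρ i

module _ (⫫ : Pole) where
  mutual
    -- falsity value  ‖A‖  (with A[X:=S] realised by extending the valuation)
    ‖_‖ : ∀ {m} → Formula m → Env m → Stack → Set₁
    ‖ ⊤' ‖    ρ π = Lift _ ⊥
    ‖ X i ‖   ρ π = Lift _ (ρ i π)
    ‖ A ⇒ B ‖ ρ π = Σ Λ λ t → Σ Π λ π' → (π ≡ t · π') × (∣ A ∣ ρ t) × (‖ B ‖ ρ π')
    ‖ A ∩ B ‖ ρ π = ‖ A ‖ ρ π ⊎ ‖ B ‖ ρ π
    ‖ ∀X A ‖  ρ π = Σ StackSet λ S → ‖ A ‖ (ρ ,, S) π

    ∣_∣ : ∀ {m} → Formula m → Env m → Λ → Set₁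
    ∣ A ∣ ρ t = ∀ π → ‖ A ‖ ρ π → carrier ⫫ (t ★ π)

emptyEnv : Env 0
emptyEnv ()

_⊩[_]_ : Λ → Pole → Formula 0 → Set₁
t ⊩[ ⫫ ] A = ∣_∣ ⫫ A emptyEnv t

_⊩ˢ[_]_ : Λ → RealizabilityStructure → Formula 0 → Set₁
t ⊩ˢ[ 𝒮 ] A = ∀ ⫫ → 𝒮 ⫫ → t ⊩[ ⫫ ] A

arrows : ∀ {m n} → Vector (Formula m) n → Formula m → Formula m
arrows {n = zero}  C B = B
arrows {n = suc n} C B = C zero ⇒ arrows (λ k → C (suc k)) B

bigCap : ∀ {m} k → Vector (Formula m) (suc k) → Formula m
bigCap zero    A = A zero
bigCap (suc k) A = A zero ∩ bigCap k (λ i → A (suc i))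

open import Data.Fin using (_≟_)
open import Relation.Nullary using (yes; no)

Cf : ∀ {n} → Fin n → Fin n → Formula 1
Cf i k with k ≟ i
... | yes _ = ⊤'
... | no  _ = X zero

Bf : ∀ {n} → Fin n → Formula 1
Bf {n} i = arrows {n = n} (Cf i) (X zero)

N : (n : ℕ) → .{{NonZero n}} → Formula 0
N (suc k) = ∀X (bigCap k Bf)

_≻[_]_ : ProcSet → RealizabilityStructure → ProcSet → Set₁
P ≻[ 𝒮 ] Q = ∀ ⫫ → 𝒮 ⫫ → (∀ q → Q q → carrier ⫫ q) → ∃ λ p → P p × carrier ⫫ p

pushAll : ∀ {n} → Vector Λ n → Stack → Stack
pushAll {zero}  t π = π
pushAll {suc n} t π = t zero · pushAll (λ i → t (suc i)) π

｛_｝ : Process → ProcSet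
｛ p ｝ q = q ≡ p

IsVoting : ∀ {ℓ} (n : ℕ) → (ProcSet → ProcSet → Set ℓ) → Λ → Set ℓ
IsVoting n _≻'_ φ =
  ∀ (t : Vector Λ n) (π : Stack) (j : Fin n) →
    ｛ φ ★ pushAll t π ｝ ≻' (λ q → ∃ λ i → i ≢ j × q ≡ (t i ★ π))

module Submission where

-- Fix a single pole ⫫.  A stack lies in ‖N_n‖ exactly when it
-- has the shape t₁·…·tₙ·π where, for some index j and some set S ∋ π of
-- stacks, every tᵢ with i ≠ j realizes S (the j-th argument is unconstrained,
-- being typed by ⊤).  Taking S = {π} shows that φ realizes N_n w.r.t. ⫫ iff
--     ∀ t π j,  (∀ i ≠ j, tᵢ ★ π ∈ ⫫)  →  φ ★ t₁·…·tₙ·π ∈ ⫫        (†)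
-- On the other side, {p} ≻_𝒮 Q says precisely: for every ⫫ ∈ 𝒮, Q ⊆ ⫫
-- implies p ∈ ⫫.  So both sides of the theorem are (†) quantified over
-- the poles of 𝒮.

open import Defs
open import Data.Nat using (ℕ; zero; suc; NonZero)
open import Data.Fin using (Fin; zero; suc) renaming (_≟_ to _≟ᶠ_)
open import Data.Product using (Σ; ∃; _×_; _,_)
open import Data.Sum using (inj₁; inj₂)
open import Data.Empty using (⊥-elim)
open import Data.Vec.Functional using (Vector; _∷_; tail)
open import Level using (lift)
open import Function.Bundles using (_⇔_; mk⇔; Equivalence)
open import Relation.Nullary using (yes; no)
open import Relation.Binary.PropositionalEquality using (_≡_; _≢_; refl; cong)

module _ (⫫ : Pole) where

  bigCap-elim : ∀ {m} k (A : Vector (Formula m) (suc k)) {ρ π} →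
    ‖_‖ ⫫ (bigCap k A) ρ π → ∃ λ i → ‖_‖ ⫫ (A i) ρ π
  bigCap-elim zero    A h        = zero , h
  bigCap-elim (suc k) A (inj₁ h) = zero , h
  bigCap-elim (suc k) A (inj₂ h) with bigCap-elim k (tail A) h
  ... | i , hᵢ = suc i , hᵢ

  bigCap-intro : ∀ {m} k (A : Vector (Formula m) (suc k)) {ρ π} i →
    ‖_‖ ⫫ (A i) ρ π → ‖_‖ ⫫ (bigCap k A) ρ π
  bigCap-intro zero    A zero    h = h
  bigCap-intro (suc k) A zero    h = inj₁ h
  bigCap-intro (suc k) A (suc i) h = inj₂ (bigCap-intro k (tail A) i h)

  arrows-elim : ∀ {m} n (C : Vector (Formula m) n) B {ρ} σ →
    ‖_‖ ⫫ (arrows C B) ρ σ →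
    Σ (Vector Λ n) λ u → Σ Π λ π →
      (σ ≡ pushAll u π) × (∀ k → ∣_∣ ⫫ (C k) ρ (u k)) × ‖_‖ ⫫ B ρ π
  arrows-elim zero    C B σ h = (λ ()) , σ , refl , (λ ()) , h
  arrows-elim (suc n) C B .(t · σ) (t , σ , refl , t⊩C₀ , h)
    with arrows-elim n (tail C) B σ h
  ... | u , π , σ≡ , u⊩C , π⊥B =
    (t ∷ u) , π , cong (t ·_) σ≡ , (λ { zero → t⊩C₀ ; (suc k) → u⊩C k }) , π⊥B

  arrows-intro : ∀ {m} n (C : Vector (Formula m) n) B {ρ} u π →
    (∀ k → ∣_∣ ⫫ (C k) ρ (u k)) → ‖_‖ ⫫ B ρ π →
    ‖_‖ ⫫ (arrows C B) ρ (pushAll u π)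
  arrows-intro zero    C B u π u⊩C π⊥B = π⊥B
  arrows-intro (suc n) C B u π u⊩C π⊥B =
    u zero , pushAll (tail u) π , refl , u⊩C zero ,
    arrows-intro n (tail C) B (tail u) π (λ k → u⊩C (suc k)) π⊥B

  Cf-off-diagonal : ∀ {n} (i k : Fin n) {ρ t} → k ≢ i →
    ∣_∣ ⫫ (Cf i k) ρ t → ∣_∣ ⫫ (X zero) ρ t
  Cf-off-diagonal i k k≢i t⊩C with k ≟ᶠ i
  ... | yes k≡i = ⊥-elim (k≢i k≡i)
  ... | no  _   = t⊩C

  Cf-intro : ∀ {n} (i k : Fin n) {ρ t} →
    (k ≢ i → ∣_∣ ⫫ (X zero) ρ t) → ∣_∣ ⫫ (Cf i k) ρ t
  Cf-intro i k t⊩X with k ≟ᶠ i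
  ... | yes _   = λ π ()
  ... | no  k≢i = t⊩X k≢i

  VotesIn : (n : ℕ) → Λ → Set
  VotesIn n φ = ∀ (t : Vector Λ n) π j →
    (∀ i → i ≢ j → carrier ⫫ (t i ★ π)) → carrier ⫫ (φ ★ pushAll t π)

  realizes-N⇔votesIn : ∀ k (φ : Λ) → (φ ⊩[ ⫫ ] N (suc k)) ⇔ VotesIn (suc k) φ
  realizes-N⇔votesIn k φ = mk⇔ realizer⇒votes votes⇒realizer
    where
    -- Instantiate X by the singleton {π} and refute the j-th conjunct B_j.
    realizer⇒votes : φ ⊩[ ⫫ ] N (suc k) → VotesIn (suc k) φ
    realizer⇒votes φ⊩N t π j others⫫ =
      φ⊩N (pushAll t π) (｛π｝ , bigCap-intro k Bf j
        (arrows-intro (suc k) (Cf j) (X zero) t π t⊩C (lift refl)))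
      where
      ｛π｝ : StackSet
      ｛π｝ σ = σ ≡ π
      t⊩C : ∀ i → ∣_∣ ⫫ (Cf j i) (emptyEnv ,, ｛π｝) (t i)
      t⊩C i = Cf-intro j i λ { i≢j σ (lift refl) → others⫫ i i≢j }

    -- A refuting stack selects a conjunct B_i; use (†) with j = i.
    votes⇒realizer : VotesIn (suc k) φ → φ ⊩[ ⫫ ] N (suc k)
    votes⇒realizer votes σ (S , σ⊥N) with bigCap-elim k Bf σ⊥N
    ... | i , σ⊥Bᵢ with arrows-elim (suc k) (Cf i) (X zero) σ σ⊥Bᵢ
    ... | u , π , refl , u⊩C , lift π∈S =
      votes u π i λ l l≢i → Cf-off-diagonal i l l≢i (u⊩C l) π (lift π∈S)

singleton-≻⇔ : (𝒮 : RealizabilityStructure) (p : Process) (Q : ProcSet) →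
  (｛ p ｝ ≻[ 𝒮 ] Q) ⇔ (∀ ⫫ → 𝒮 ⫫ → (∀ q → Q q → carrier ⫫ q) → carrier ⫫ p)
singleton-≻⇔ 𝒮 p Q = mk⇔
  (λ p≻Q ⫫ ⫫∈𝒮 Q⊆⫫ → witness-in-pole ⫫ (p≻Q ⫫ ⫫∈𝒮 Q⊆⫫))
  (λ p∈ ⫫ ⫫∈𝒮 Q⊆⫫ → p , refl , p∈ ⫫ ⫫∈𝒮 Q⊆⫫)
  where
  witness-in-pole : ∀ ⫫ → ∃ (λ q → ｛ p ｝ q × carrier ⫫ q) → carrier ⫫ p
  witness-in-pole ⫫ (.p , refl , p∈⫫) = p∈⫫

mainTheorem4 : (𝒮 : RealizabilityStructure) (n : ℕ) .{{_ : NonZero n}} (φ : Λ) →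
    (φ ⊩ˢ[ 𝒮 ] N n) ⇔ IsVoting n (λ P Q → P ≻[ 𝒮 ] Q) φ
mainTheorem4 𝒮 (suc k) φ = mk⇔ realizer⇒voting voting⇒realizer
  where
  open Equivalence

  others : Vector Λ (suc k) → Stack → Fin (suc k) → ProcSet
  others t π j q = ∃ λ i → i ≢ j × q ≡ (t i ★ π)

  realizer⇒voting : φ ⊩ˢ[ 𝒮 ] N (suc k) → IsVoting (suc k) (λ P Q → P ≻[ 𝒮 ] Q) φ
  realizer⇒voting φ⊩N t π j = from (singleton-≻⇔ 𝒮 _ (others t π j))
    λ ⫫ ⫫∈𝒮 others⊆⫫ → to (realizes-N⇔votesIn ⫫ k φ) (φ⊩N ⫫ ⫫∈𝒮) t π j
      λ i i≢j → others⊆⫫ (t i ★ π) (i , i≢j , refl)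

  voting⇒realizer : IsVoting (suc k) (λ P Q → P ≻[ 𝒮 ] Q) φ → φ ⊩ˢ[ 𝒮 ] N (suc k)
  voting⇒realizer voting ⫫ ⫫∈𝒮 = from (realizes-N⇔votesIn ⫫ k φ)
    λ t π j others⫫ → to (singleton-≻⇔ 𝒮 _ (others t π j)) (voting t π j) ⫫ ⫫∈𝒮
      λ { q (i , i≢j , refl) → others⫫ i i≢j }
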